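{- Let \(\mathbb{E}\) be the set of positive even integers, \(N\subseteq\mathbb{E}\), \(F\) an ultrafilter over a set \(I\), \(\mathbf{S}\) a subalgebra of \(\mathbf{D}_N^I/F\) with universe \(S\), and for each \(Y\in D_N\) let \(\bar{Y}\colon I\to D_N\) be the constant map with value \(Y\). Let \(\gamma(x)=\Box\Diamond x\) be the natural closure operator of \(\mathbf{S}\), let \(P=\{b_1,c_1,d\}\), and let \(X\in D_N^I\) with \(X/F\in S\) and \(X/F\neq\bar{\varnothing}/F\). Then: (i) if \(\{i\in I\mid P\cap X(i)=\varnothing\}\in F\), then \(\bar{\{d\}}/F\in S\); (ii) if \(\{i\in I\mid P\subseteq\Diamond X(i)\}\in F\) and \(\Diamond X/F\neq\bar{W}/F\), then \(\bar{\{d\}}/F\in S\); (iii) if \(\{i\in I\mid P\subseteq\Diamond(W\setminus X(i))\}\in F\), \(\Diamond X/F\neq\bar{W}/F\), \(\Diamond^2X/F=\bar{W}/F\), and \(\gamma(X/F)=X/F\), then \(\bar{\{d\}}/F\in S\).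
   Context: The complex algebra \(\mathsf{Cm}(\langle W;R\rangle)\) is the power set Boolean algebra of \(W\) with \(\Diamond X=\{w\in W\mid w\,R\,x\text{ for some }x\in X\}\), \(\Box X=W\setminus\Diamond(W\setminus X)\). The frame \(\mathbb{F}_N=\langle W;R_N\rangle\): \(W\) consists of pairwise distinct elements \(a,b_1,b_2,b_3,c_1,c_2,d\), \(u_i\) (\(i\geqslant 1\)) and \(\ell_i\) (\(i\geqslant 0\)); \(R_N\) is the reflexive symmetric relation on \(W\) whose non-loop edges \(\{x,y\}\) are exactly: \(\{a,b_i\}\) for \(i\in\{1,2,3\}\); \(\{b_i,c_i\}\) for \(i\in\{1,2\}\); \(\{c_1,d\}\); \(\{\ell_0,\ell_1\}\); \(\{a,\ell_i\}\) for all \(i\geqslant 0\); \(\{\ell_i,u_i\}\) for all \(i\geqslant 1\); \(\{\ell_i,u_{i-1}\}\) for \(i\in\mathbb{E}\); \(\{\ell_i,u_{i+1}\}\) for \(i\in N\); \(\{\ell_{i+1},u_i\}\) for \(i\in\mathbb{E}\setminus N\). \(\mathbf{D}_N\) is the subalgebra of \(\mathsf{Cm}(\mathbb{F}_N)\) generated by \(\{d\}\), with universe \(D_N\). Operations on \(D_N^I\) are computed coordinatewise, so \((\Diamond X)(i)=\Diamond(X(i))\). -}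

module Defs where

open import Data.Nat using (ℕ; zero; suc; _*_)
open import Data.Product using (Σ; ∃; _×_; _,_)
open import Data.Sum using (_⊎_)
open import Data.Empty using (⊥)
open import Data.Unit using (⊤)
open import Relation.Nullary using (¬_)
open import Relation.Binary.PropositionalEquality using (_≡_)

𝔼 : ℕ → Set
𝔼 i = Σ ℕ λ k → i ≡ 2 * suc k

-- The set W.  Convention: `u⁺ m` denotes u_{m+1} (so the u's are u_i,
-- i ≥ 1), `ℓ i` denotes ℓ_i (i ≥ 0).

data W : Set where
  a b₁ b₂ b₃ c₁ c₂ d : W
  u⁺ : ℕ → W
  ℓ  : ℕ → W

-- The non-loop edges of F_N (one orientation each); N is a predicate on ℕ.
data Edge (N : ℕ → Set) : W → W → Set where
  ab₁ : Edge N a b₁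
  ab₂ : Edge N a b₂
  ab₃ : Edge N a b₃
  b₁c₁ : Edge N b₁ c₁
  b₂c₂ : Edge N b₂ c₂
  c₁d : Edge N c₁ d
  ℓ₀ℓ₁ : Edge N (ℓ 0) (ℓ 1)
  aℓ : (i : ℕ) → Edge N a (ℓ i)
  -- {ℓ_i , u_i} for i ≥ 1   (i = m+1)
  ℓu : (m : ℕ) → Edge N (ℓ (suc m)) (u⁺ m)
  -- {ℓ_i , u_{i-1}} for i ∈ 𝔼   (i = m+2, u_{i-1} = u_{m+1})
  ℓu-pred : (m : ℕ) → 𝔼 (suc (suc m)) → Edge N (ℓ (suc (suc m))) (u⁺ m)
  -- {ℓ_i , u_{i+1}} for i ∈ N
  ℓu-succ : (i : ℕ) → N i → Edge N (ℓ i) (u⁺ i)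
  -- {ℓ_{i+1} , u_i} for i ∈ 𝔼 ∖ N   (i = m+1)
  ℓsu : (m : ℕ) → 𝔼 (suc m) → ¬ N (suc m) → Edge N (ℓ (suc (suc m))) (u⁺ m)

R : (N : ℕ → Set) → W → W → Set
R N x y = x ≡ y ⊎ Edge N x y ⊎ Edge N y x

Sub : Set₁
Sub = W → Set

_⊆_ : Sub → Sub → Set
X ⊆ Y = ∀ w → X w → Y w

_≐_ : Sub → Sub → Set
X ≐ Y = (X ⊆ Y) × (Y ⊆ X)

∅ : Sub
∅ _ = ⊥

Wᶠ : Sub
Wᶠ _ = ⊤

_∪_ : Sub → Sub → Sub
(X ∪ Y) w = X w ⊎ Y w

_∩_ : Sub → Sub → Sub
(X ∩ Y) w = X w × Y w

∁ : Sub → Sub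
∁ X w = ¬ X w

single : W → Sub
single x w = w ≡ x

◇ : (N : ℕ → Set) → Sub → Sub
◇ N X w = ∃ λ x → R N w x × X x

□ : (N : ℕ → Set) → Sub → Sub
□ N X = ∁ (◇ N (∁ X))

-- D_N : the subalgebra of Cm(F_N) generated by {d}.  Its elements are
-- exactly the values of modal-algebra terms in one variable evaluated at
-- {d}; we represent an element of D_N by such a term, and equality in D_N
-- is equality (≐) of the denoted subsets.

data DN : Set where
  gen : DN
  bot top : DN
  _∨ᵗ_ _∧ᵗ_ : DN → DN → DN
  ¬ᵗ_ : DN → DN
  ◇ᵗ_ : DN → DN

⟦_⟧ : DN → (N : ℕ → Set) → Sub
⟦ gen ⟧ N = single d
⟦ bot ⟧ N = ∅
⟦ top ⟧ N = Wᶠ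
⟦ s ∨ᵗ t ⟧ N = ⟦ s ⟧ N ∪ ⟦ t ⟧ N
⟦ s ∧ᵗ t ⟧ N = ⟦ s ⟧ N ∩ ⟦ t ⟧ N
⟦ ¬ᵗ s ⟧ N = ∁ (⟦ s ⟧ N)
⟦ ◇ᵗ s ⟧ N = ◇ N (⟦ s ⟧ N)

□ᵗ_ : DN → DN
□ᵗ s = ¬ᵗ (◇ᵗ (¬ᵗ s))

record Ultrafilter (I : Set) (F : (I → Set) → Set) : Set₁ where
  field
    whole    : F (λ _ → ⊤)
    proper   : ¬ F (λ _ → ⊥)
    upward   : ∀ {A B : I → Set} → (∀ i → A i → B i) → F A → F B
    meet     : ∀ {A B : I → Set} → F A → F B → F (λ i → A i × B i)
    ultra    : ∀ (A : I → Set) → F A ⊎ F (λ i → ¬ A i)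

-- The ultrapower D_N^I / F.  Elements of D_N^I are maps I → DN; operations
-- are coordinatewise; X/F = Y/F iff {i | X(i) = Y(i)} ∈ F.

module Ultrapower (N : ℕ → Set) (I : Set) (F : (I → Set) → Set) where

  _~_ : (I → DN) → (I → DN) → Set
  X ~ Y = F (λ i → ⟦ X i ⟧ N ≐ ⟦ Y i ⟧ N)

  const : DN → I → DN
  const Y _ = Y

  ◇ᴵ : (I → DN) → I → DN
  ◇ᴵ X i = ◇ᵗ X i

  □ᴵ : (I → DN) → I → DN
  □ᴵ X i = □ᵗ X i

  γ : (I → DN) → I → DN
  γ X = □ᴵ (◇ᴵ X)

  -- A subalgebra of D_N^I/F, given by its universe S ⊆ D_N^I/F, i.e. an
  -- ~-saturated predicate on representatives closed under all operations.
  record IsSubalgebra (S : (I → DN) → Set) : Set where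
    field
      saturated : ∀ {X Y} → X ~ Y → S X → S Y
      has-bot   : S (const bot)
      has-top   : S (const top)
      ∨-closed  : ∀ {X Y} → S X → S Y → S (λ i → X i ∨ᵗ Y i)
      ∧-closed  : ∀ {X Y} → S X → S Y → S (λ i → X i ∧ᵗ Y i)
      ¬-closed  : ∀ {X} → S X → S (λ i → ¬ᵗ X i)
      ◇-closed  : ∀ {X} → S X → S (◇ᴵ X)

P : Sub
P w = w ≡ b₁ ⊎ w ≡ c₁ ⊎ w ≡ d

module Submission where

open import Defs
open import Level using (0ℓ)
open import Data.Nat using (ℕ; zero; suc; _+_; _≤_; _<_; z≤n; s≤s)
open import Data.Nat.Properties using (≤ᵇ⇒≤; ≤-trans; n≤1+n; <⇒≱; ≮⇒≥; m≤n⇒m<n∨m≡n)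
open import Data.Nat.Induction using (<-wellFounded)
open import Data.Product using (_×_; _,_; proj₁; proj₂; ∃; ∃-syntax)
open import Data.Sum using (_⊎_; inj₁; inj₂)
open import Data.Empty using (⊥-elim)
open import Data.Unit using (tt)
open import Induction.WellFounded using (Acc; acc)
open import Relation.Nullary using (¬_; yes; no)
open import Relation.Binary.PropositionalEquality using (_≡_; _≢_; refl; subst)
open import Axiom.ExcludedMiddle using (ExcludedMiddle)
open import Axiom.DoubleNegationElimination using (em⇒dne)

-- In F_N, depth w is the distance from w to d.  Hence □ᵏ(W ∖ Y) = {d} as soon as Y avoids
-- the ball of radius k around d while every w ≠ d has a point of Y within k steps.  Every
-- w ≠ d is within 2 steps of a, and every point off P = {b₁, c₁, d} is reached from a in
-- depth − 3 steps; so for Y nonempty and disjoint from P, and z ∈ Y of least depth,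
-- k = depth z − 1 ∈ {2, 3, 4} works.  In (i), (ii), (iii) the element T = X, ¬◇X, □X of S
-- is F-almost everywhere nonempty and disjoint from P; as k ranges over a finite set, a
-- single k works F-almost everywhere, and then □ᵏ¬T / F = {d}‾ / F lies in S.

□ᵗ^ : ℕ → DN → DN
□ᵗ^ zero s = s
□ᵗ^ (suc k) s = □ᵗ^ k (□ᵗ s)

least : ExcludedMiddle 0ℓ → {A : Set} (f : A → ℕ) {Y : A → Set} →
        ∃ Y → ∃ λ z → Y z × (∀ y → Y y → f z ≤ f y)
least em f {Y} (z , yz) = go z (<-wellFounded (f z)) yz
  where
  go : ∀ z → Acc _<_ (f z) → Y z → ∃ λ z → Y z × (∀ y → Y y → f z ≤ f y)
  go z (acc smaller) yz with em {∃ λ y → Y y × f y < f z}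
  ... | yes (y , yy , fy<fz) = go y (smaller fy<fz) yy
  ... | no none = z , yz , λ y yy → ≮⇒≥ (λ fy<fz → none (y , yy , fy<fz))

∃≤-suc : ∀ {n} {A : ℕ → Set} → (∃[ k ] k ≤ suc n × A k) → A (suc n) ⊎ (∃[ k ] k ≤ n × A k)
∃≤-suc (k , k≤1+n , ak) with m≤n⇒m<n∨m≡n k≤1+n
... | inj₁ (s≤s k≤n) = inj₂ (k , k≤n , ak)
... | inj₂ refl = inj₁ ak

module Frame (N : ℕ → Set) where

  R-refl : ∀ {x} → R N x x
  R-refl = inj₁ refl

  edge⁺ : ∀ {x y} → Edge N x y → R N x y
  edge⁺ e = inj₂ (inj₁ e)

  edge⁻ : ∀ {x y} → Edge N y x → R N x y
  edge⁻ e = inj₂ (inj₂ e)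

  depth : W → ℕ
  depth d = 0
  depth c₁ = 1
  depth b₁ = 2
  depth a = 3
  depth b₂ = 4
  depth b₃ = 4
  depth (ℓ _) = 4
  depth c₂ = 5
  depth (u⁺ _) = 5

  edge-depth : ∀ {x y} → Edge N x y → depth y ≤ suc (depth x) × depth x ≤ suc (depth y)
  edge-depth ab₁ = ≤ᵇ⇒≤ _ _ _ , ≤ᵇ⇒≤ _ _ _
  edge-depth ab₂ = ≤ᵇ⇒≤ _ _ _ , ≤ᵇ⇒≤ _ _ _
  edge-depth ab₃ = ≤ᵇ⇒≤ _ _ _ , ≤ᵇ⇒≤ _ _ _
  edge-depth b₁c₁ = ≤ᵇ⇒≤ _ _ _ , ≤ᵇ⇒≤ _ _ _
  edge-depth b₂c₂ = ≤ᵇ⇒≤ _ _ _ , ≤ᵇ⇒≤ _ _ _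
  edge-depth c₁d = ≤ᵇ⇒≤ _ _ _ , ≤ᵇ⇒≤ _ _ _
  edge-depth ℓ₀ℓ₁ = ≤ᵇ⇒≤ _ _ _ , ≤ᵇ⇒≤ _ _ _
  edge-depth (aℓ _) = ≤ᵇ⇒≤ _ _ _ , ≤ᵇ⇒≤ _ _ _
  edge-depth (ℓu _) = ≤ᵇ⇒≤ _ _ _ , ≤ᵇ⇒≤ _ _ _
  edge-depth (ℓu-pred _ _) = ≤ᵇ⇒≤ _ _ _ , ≤ᵇ⇒≤ _ _ _
  edge-depth (ℓu-succ _ _) = ≤ᵇ⇒≤ _ _ _ , ≤ᵇ⇒≤ _ _ _
  edge-depth (ℓsu _ _ _) = ≤ᵇ⇒≤ _ _ _ , ≤ᵇ⇒≤ _ _ _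

  depth-step : ∀ {x y} → R N x y → depth y ≤ suc (depth x)
  depth-step (inj₁ refl) = n≤1+n _
  depth-step (inj₂ (inj₁ e)) = proj₁ (edge-depth e)
  depth-step (inj₂ (inj₂ e)) = proj₂ (edge-depth e)

  Walk : ℕ → W → W → Set
  Walk zero w y = w ≡ y
  Walk (suc k) w y = ∃ λ x → Walk k w x × R N x y

  walk-from-d-depth : ∀ {k y} → Walk k d y → depth y ≤ k
  walk-from-d-depth {zero} refl = z≤n
  walk-from-d-depth {suc k} (x , p , r) = ≤-trans (depth-step r) (s≤s (walk-from-d-depth p))

  walk₂ : ∀ {w x y} → R N w x → R N x y → Walk 2 w y
  walk₂ r r′ = _ , (_ , refl , r) , r′

  walk-to-a : ∀ w → w ≢ d → Walk 2 w a
  walk-to-a a _ = walk₂ R-refl R-refl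
  walk-to-a b₁ _ = walk₂ (edge⁻ ab₁) R-refl
  walk-to-a b₂ _ = walk₂ (edge⁻ ab₂) R-refl
  walk-to-a b₃ _ = walk₂ (edge⁻ ab₃) R-refl
  walk-to-a c₁ _ = walk₂ (edge⁻ b₁c₁) (edge⁻ ab₁)
  walk-to-a c₂ _ = walk₂ (edge⁻ b₂c₂) (edge⁻ ab₂)
  walk-to-a d w≢d = ⊥-elim (w≢d refl)
  walk-to-a (u⁺ m) _ = walk₂ (edge⁻ (ℓu m)) (edge⁻ (aℓ (suc m)))
  walk-to-a (ℓ i) _ = walk₂ (edge⁻ (aℓ i)) R-refl

  walk-to : ∀ {k} z → depth z ≡ 3 + k → ∀ w → w ≢ d → Walk (2 + k) w z
  walk-to a refl w w≢d = walk-to-a w w≢d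
  walk-to b₂ refl w w≢d = a , walk-to-a w w≢d , edge⁺ ab₂
  walk-to b₃ refl w w≢d = a , walk-to-a w w≢d , edge⁺ ab₃
  walk-to (ℓ i) refl w w≢d = a , walk-to-a w w≢d , edge⁺ (aℓ i)
  walk-to c₂ refl w w≢d = b₂ , (a , walk-to-a w w≢d , edge⁺ ab₂) , edge⁺ b₂c₂
  walk-to (u⁺ m) refl w w≢d = ℓ (suc m) , (a , walk-to-a w w≢d , edge⁺ (aℓ (suc m))) , edge⁺ (ℓu m)

  depth-off-P : ∀ z → ¬ P z → ∃[ k ] k ≤ 2 × depth z ≡ 3 + k
  depth-off-P a _ = 0 , z≤n , refl
  depth-off-P b₂ _ = 1 , s≤s z≤n , refl
  depth-off-P b₃ _ = 1 , s≤s z≤n , refl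
  depth-off-P (ℓ _) _ = 1 , s≤s z≤n , refl
  depth-off-P c₂ _ = 2 , s≤s (s≤s z≤n) , refl
  depth-off-P (u⁺ _) _ = 2 , s≤s (s≤s z≤n) , refl
  depth-off-P b₁ ¬Pz = ⊥-elim (¬Pz (inj₁ refl))
  depth-off-P c₁ ¬Pz = ⊥-elim (¬Pz (inj₂ (inj₁ refl)))
  depth-off-P d ¬Pz = ⊥-elim (¬Pz (inj₂ (inj₂ refl)))

  R-b₃-elim : ∀ {Q : W → Set} → Q b₃ → Q a → ∀ x → R N b₃ x → Q x
  R-b₃-elim qb₃ qa .b₃ (inj₁ refl) = qb₃
  R-b₃-elim qb₃ qa .a (inj₂ (inj₂ ab₃)) = qa

  R-c₂-elim : ∀ {Q : W → Set} → Q c₂ → Q b₂ → ∀ x → R N c₂ x → Q x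
  R-c₂-elim qc₂ qb₂ .c₂ (inj₁ refl) = qc₂
  R-c₂-elim qc₂ qb₂ .b₂ (inj₂ (inj₂ b₂c₂)) = qb₂

  R-b₂-elim : ∀ {Q : W → Set} → Q b₂ → Q c₂ → Q a → ∀ x → R N b₂ x → Q x
  R-b₂-elim qb₂ qc₂ qa .b₂ (inj₁ refl) = qb₂
  R-b₂-elim qb₂ qc₂ qa .c₂ (inj₂ (inj₁ b₂c₂)) = qc₂
  R-b₂-elim qb₂ qc₂ qa .a (inj₂ (inj₂ ab₂)) = qa

  □-intro : ∀ {Z : Sub} {w} → (∀ x → R N w x → Z x) → □ N Z w
  □-intro all (x , r , ¬Zx) = ¬Zx (all x r)

module Semantics (em : ExcludedMiddle 0ℓ) (N : ℕ → Set) where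
  open Frame N

  dne : ∀ {A : Set} → ¬ ¬ A → A
  dne = em⇒dne em

  inhabited : (Y : Sub) → ¬ (Y ≐ ∅) → ∃ Y
  inhabited Y Y≢∅ = dne λ none → Y≢∅ ((λ w y → none (w , y)) , λ _ ())

  co-inhabited : (Y : Sub) → ¬ (Y ≐ Wᶠ) → ∃ (∁ Y)
  co-inhabited Y Y≢W = dne λ none → Y≢W ((λ _ _ → tt) , λ w _ → dne λ ¬Yw → none (w , ¬Yw))

  □ᵗ^-elim : ∀ k s {w y} → ⟦ □ᵗ^ k s ⟧ N w → Walk k w y → ⟦ s ⟧ N y
  □ᵗ^-elim zero s q refl = q
  □ᵗ^-elim (suc k) s q (x , p , r) = dne λ ¬sy → □ᵗ^-elim k (□ᵗ s) q p (_ , r , ¬sy)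

  □ᵗ^-intro : ∀ k s {w} → (∀ y → Walk k w y → ⟦ s ⟧ N y) → ⟦ □ᵗ^ k s ⟧ N w
  □ᵗ^-intro zero s all = all _ refl
  □ᵗ^-intro (suc k) s all = □ᵗ^-intro k (□ᵗ s) λ x p → □-intro λ y r → all y (x , p , r)

  □ᵗ^¬-≐-single-d : ∀ k t → (∀ w → w ≢ d → ∃ λ y → ⟦ t ⟧ N y × Walk k w y) →
                    (∀ y → ⟦ t ⟧ N y → k < depth y) → ⟦ □ᵗ^ k (¬ᵗ t) ⟧ N ≐ single d
  □ᵗ^¬-≐-single-d k t reach far = ⊆single-d , single-d⊆
    where
    ⊆single-d : ⟦ □ᵗ^ k (¬ᵗ t) ⟧ N ⊆ single d
    ⊆single-d w q = dne λ w≢d → let (y , ty , p) = reach w w≢d in □ᵗ^-elim k (¬ᵗ t) q p ty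
    single-d⊆ : single d ⊆ ⟦ □ᵗ^ k (¬ᵗ t) ⟧ N
    single-d⊆ .d refl = □ᵗ^-intro k (¬ᵗ t) λ y p ty → <⇒≱ (far y ty) (walk-from-d-depth p)

  isolate-d : (t : DN) → (∀ w → P w → ¬ ⟦ t ⟧ N w) → ∃ (⟦ t ⟧ N) →
              ∃[ k ] k ≤ 2 × ⟦ □ᵗ^ (2 + k) (¬ᵗ t) ⟧ N ≐ single d
  isolate-d t disjoint inhabited-t with least em depth inhabited-t
  ... | z , tz , z-least with depth-off-P z (λ Pz → disjoint z Pz tz)
  ... | k , k≤2 , depth-z = k , k≤2 , □ᵗ^¬-≐-single-d (2 + k) t
          (λ w w≢d → z , tz , walk-to z depth-z w w≢d)
          (λ y ty → subst (_≤ depth y) depth-z (z-least y ty))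

  -- If a ∈ Y then b₃ ∈ □Y.  Otherwise Y meets {b₂, c₂} (as c₂ ∈ ◇²Y), so b₂, c₂ ∈ □◇Y ⊆ Y
  -- and c₂ ∈ □Y.
  □-inhabited : (Y : Sub) → (∀ w → ◇ N (◇ N Y) w) → □ N (◇ N Y) ⊆ Y → ∃ (□ N Y)
  □-inhabited Y dense closed with em {Y a}
  ... | yes Ya = b₃ , □-intro (R-b₃-elim {Y} Yb₃ Ya)
    where
    Yb₃ : Y b₃
    Yb₃ = closed b₃ (□-intro (R-b₃-elim {◇ N Y} (a , edge⁻ ab₃ , Ya) (a , R-refl , Ya)))
  ... | no ¬Ya = c₂ , □-intro (R-c₂-elim {Y} Yc₂ Yb₂)
    where
    ◇Ya : ◇ N Y a
    ◇Ya with dense b₃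
    ... | .a , inj₂ (inj₂ ab₃) , ◇Ya = ◇Ya
    ... | .b₃ , inj₁ refl , .b₃ , inj₁ refl , Yb₃ = b₃ , edge⁺ ab₃ , Yb₃
    ... | .b₃ , inj₁ refl , .a , inj₂ (inj₂ ab₃) , Ya = a , R-refl , Ya
    Yb₂⊎Yc₂ : Y b₂ ⊎ Y c₂
    Yb₂⊎Yc₂ with dense c₂
    ... | .c₂ , inj₁ refl , .c₂ , inj₁ refl , Yc₂ = inj₂ Yc₂
    ... | .c₂ , inj₁ refl , .b₂ , inj₂ (inj₂ b₂c₂) , Yb₂ = inj₁ Yb₂
    ... | .b₂ , inj₂ (inj₂ b₂c₂) , .b₂ , inj₁ refl , Yb₂ = inj₁ Yb₂
    ... | .b₂ , inj₂ (inj₂ b₂c₂) , .c₂ , inj₂ (inj₁ b₂c₂) , Yc₂ = inj₂ Yc₂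
    ... | .b₂ , inj₂ (inj₂ b₂c₂) , .a , inj₂ (inj₂ ab₂) , Ya = ⊥-elim (¬Ya Ya)
    ◇Yb₂ : ◇ N Y b₂
    ◇Yb₂ with Yb₂⊎Yc₂
    ... | inj₁ Yb₂ = b₂ , R-refl , Yb₂
    ... | inj₂ Yc₂ = c₂ , edge⁺ b₂c₂ , Yc₂
    ◇Yc₂ : ◇ N Y c₂
    ◇Yc₂ with Yb₂⊎Yc₂
    ... | inj₁ Yb₂ = b₂ , edge⁻ b₂c₂ , Yb₂
    ... | inj₂ Yc₂ = c₂ , R-refl , Yc₂
    Yc₂ : Y c₂
    Yc₂ = closed c₂ (□-intro (R-c₂-elim {◇ N Y} ◇Yc₂ ◇Yb₂))
    Yb₂ : Y b₂
    Yb₂ = closed b₂ (□-intro (R-b₂-elim {◇ N Y} ◇Yb₂ ◇Yc₂ ◇Ya))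

module UltrapowerLemmas (em : ExcludedMiddle 0ℓ) (N : ℕ → Set) (I : Set) (F : (I → Set) → Set)
                        (uf : Ultrafilter I F) where
  open Semantics em N
  open Ultrapower N I F
  open Ultrafilter uf

  F-⊎ : ∀ {A B : I → Set} → F (λ i → A i ⊎ B i) → F A ⊎ F B
  F-⊎ {A} {B} FA⊎B with ultra A
  ... | inj₁ FA = inj₁ FA
  ... | inj₂ F¬A = inj₂ (upward (λ { i (inj₁ Ai , ¬Ai) → ⊥-elim (¬Ai Ai) ; i (inj₂ Bi , _) → Bi })
                                (meet FA⊎B F¬A))

  F-∃≤ : ∀ n (A : ℕ → I → Set) → F (λ i → ∃[ k ] k ≤ n × A k i) → ∃[ k ] F (A k)
  F-∃≤ zero A F∃ = 0 , upward (λ { i (.0 , z≤n , A0i) → A0i }) F∃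
  F-∃≤ (suc n) A F∃ with F-⊎ (upward (λ i → ∃≤-suc {A = λ k → A k i}) F∃)
  ... | inj₁ FA = suc n , FA
  ... | inj₂ F∃≤n = F-∃≤ n A F∃≤n

  F-¬ : ∀ {A : I → Set} → ¬ F A → F (λ i → ¬ A i)
  F-¬ {A} ¬FA with ultra A
  ... | inj₁ FA = ⊥-elim (¬FA FA)
  ... | inj₂ F¬A = F¬A

  module _ {S : (I → DN) → Set} (sub : IsSubalgebra S) where
    open IsSubalgebra sub

    S-□ : ∀ {T} → S T → S (λ i → □ᵗ T i)
    S-□ sT = ¬-closed (◇-closed (¬-closed sT))

    S-□ᵗ^ : ∀ k {T} → S T → S (λ i → □ᵗ^ k (T i))
    S-□ᵗ^ zero sT = sT
    S-□ᵗ^ (suc k) sT = S-□ᵗ^ k (S-□ sT)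

    gen∈S : ∀ {T} → S T → F (λ i → (∀ w → P w → ¬ ⟦ T i ⟧ N w) × ∃ (⟦ T i ⟧ N)) → S (const gen)
    gen∈S {T} sT F-isolable
      with F-∃≤ 2 (λ k i → ⟦ □ᵗ^ (2 + k) (¬ᵗ T i) ⟧ N ≐ single d)
                  (upward (λ i (disjoint , inhabited-T) → isolate-d (T i) disjoint inhabited-T) F-isolable)
    ... | k , F≐single-d = saturated F≐single-d (S-□ᵗ^ (2 + k) (¬-closed sT))

lemma3p11 : ExcludedMiddle 0ℓ →
    (N : ℕ → Set) → (∀ i → N i → 𝔼 i) →
    (I : Set) (F : (I → Set) → Set) → Ultrafilter I F →
    let open Ultrapower N I F in
    (S : (I → DN) → Set) → IsSubalgebra S →
    (X : I → DN) → S X → ¬ (X ~ const bot) →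
      (F (λ i → (P ∩ ⟦ X i ⟧ N) ≐ ∅) → S (const gen))
      × (F (λ i → P ⊆ ◇ N (⟦ X i ⟧ N)) → ¬ (◇ᴵ X ~ const top) → S (const gen))
      × (F (λ i → P ⊆ ◇ N (∁ (⟦ X i ⟧ N))) → ¬ (◇ᴵ X ~ const top)
          → ◇ᴵ (◇ᴵ X) ~ const top → γ X ~ X → S (const gen))
lemma3p11 em N _ I F uf S sub X sX X≁∅ =
    (λ P∩X≐∅ → gen∈S sub sX
      (upward (λ i (P∩X≐∅ , X≢∅) → (λ w Pw Xw → proj₁ P∩X≐∅ w (Pw , Xw)) , inhabited _ X≢∅)
              (meet P∩X≐∅ (F-¬ X≁∅))))
  , (λ P⊆◇X ◇X≁W → gen∈S sub (¬-closed (◇-closed sX))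
      (upward (λ i (P⊆◇X , ◇X≢W) → (λ w Pw ¬◇Xw → ¬◇Xw (P⊆◇X w Pw)) , co-inhabited _ ◇X≢W)
              (meet P⊆◇X (F-¬ ◇X≁W))))
  , (λ P⊆◇∁X _ ◇◇X~W γX~X → gen∈S sub (S-□ sub sX)
      (upward (λ i (P⊆◇∁X , ◇◇X≐W , γX≐X) → (λ w Pw □Xw → □Xw (P⊆◇∁X w Pw))
                                            , □-inhabited _ (λ w → proj₂ ◇◇X≐W w tt) (proj₁ γX≐X))
              (meet P⊆◇∁X (meet ◇◇X~W γX~X))))
  where
  open Semantics em N
  open UltrapowerLemmas em N I F uf
  open Ultrafilter uf
  open Ultrapower.IsSubalgebra sub
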